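{- Let $\mathcal{A}$ be a strongly connected $d$-dimensional VASS, and let $f$ be a QRF for $\mathcal{A}$ which maximizes the number of $f$-ranked transitions, with normal $\mathbf{c}_f$. Then for each vector $\mathbf{v}\in\mathit{Inc}$ with $\mathbf{c}_f^\top\mathbf{v}=0$ there exists a vector $\mathbf{w}\in\mathrm{cone}(\mathit{Inc})$ such that $\mathbf{v}+\mathbf{w}\ge\vec0$.
   Context: A $d$-dimensional VASS is a pair $\mathcal{A}=(Q,T)$ with $Q$ a finite nonempty set of states and $T\subseteq Q\times\mathbb{Z}^d\times Q$ a finite set of transitions such that every state has an outgoing transition. A finite path is $p_0,\mathbf{u}_1,p_1,\dots,\mathbf{u}_n,p_n$ with $n\ge1$ and $(p_i,\mathbf{u}_{i+1},p_{i+1})\in T$; it is a cycle if $p_0=p_n$, simple if moreover $p_1,\dots,p_{n-1}$ are pairwise distinct; its effect is $\mathbf{u}_1+\dots+\mathbf{u}_n$. $\mathcal{A}$ is strongly connected if there is a finite path between any two states. $\mathit{Inc}$ is the set of effects of simple cycles of $\mathcal{A}$; $\mathrm{cone}(X)$ is the set of non-negative real combinations of elements of $X$. A linear map is $f(p\mathbf{v})=\mathbf{c}_f^\top\mathbf{v}+\mathbf{w}_f(p)$ with $\mathbf{c}_f\in\mathbb{Q}^d$, $\mathbf{w}_f\in\mathbb{Q}^Q$; a transition $(p,\mathbf{u},q)$ is $f$-ranked if $\mathbf{c}_f^\top\mathbf{u}+\mathbf{w}_f(q)\le\mathbf{w}_f(p)-1$ and $f$-neutral if $\mathbf{c}_f^\top\mathbf{u}+\mathbf{w}_f(q)=\mathbf{w}_f(p)$.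 A QRF is a linear map with $\mathbf{c}_f\ge\vec0$ such that every transition is $f$-ranked or $f$-neutral; "maximizes the number of $f$-ranked transitions" is among all QRFs for $\mathcal{A}$. -}

module Defs where

open import Data.Nat as ℕ using (ℕ; zero; suc)
open import Data.Fin using (Fin; zero; suc)
open import Data.Integer as ℤ using (ℤ)
open import Data.Rational as ℚ using (ℚ; 0ℚ; 1ℚ)
open import Data.Rational.Properties using (_≤?_; _≟_)
open import Data.List using (List; []; _∷_; length; filter; allFin)
open import Data.List.Relation.Unary.All using (All)
open import Data.List.Relation.Unary.Unique.Propositional using (Unique)
open import Data.Product using (Σ; ∃; _×_; _,_)
open import Data.Sum using (_⊎_)
open import Relation.Binary.PropositionalEquality using (_≡_; _≢_)
open import Relation.Nullary using (Dec)

toℚ : ℤ → ℚ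
toℚ z = z ℚ./ 1

sumℚ : (d : ℕ) → (Fin d → ℚ) → ℚ
sumℚ zero    f = 0ℚ
sumℚ (suc d) f = f zero ℚ.+ sumℚ d (λ i → f (suc i))

dot : {d : ℕ} → (Fin d → ℚ) → (Fin d → ℤ) → ℚ
dot {d} c u = sumℚ d (λ i → c i ℚ.* toℚ (u i))

-- A d-dimensional VASS: states Fin nQ (nonempty), transitions Fin nT,
-- transition t = (src t, eff t, tgt t); T is a *set* of triples (no duplicates),
-- and every state has an outgoing transition.
record VASS (d : ℕ) : Set where
  field
    nQ       : ℕ
    nonempty : 0 ℕ.< nQ
    nT       : ℕ
    src      : Fin nT → Fin nQ
    eff      : Fin nT → Fin d → ℤ
    tgt      : Fin nT → Fin nQ
    noDup    : ∀ s t → src s ≡ src t → (∀ i → eff s i ≡ eff t i) → tgt s ≡ tgt t → s ≡ t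
    outgoing : ∀ (p : Fin nQ) → ∃ λ t → src t ≡ p

module _ {d : ℕ} (A : VASS d) where
  open VASS A

  -- A list of transitions t₁ … tₖ forms a path from p to q
  -- (for k ≥ 1 this is the path p, eff t₁, tgt t₁, …, eff tₖ, tgt tₖ = q)
  IsPath : Fin nQ → List (Fin nT) → Fin nQ → Set
  IsPath p []       q = p ≡ q
  IsPath p (t ∷ ts) q = src t ≡ p × IsPath (tgt t) ts q

  FinitePath : Fin nQ → List (Fin nT) → Fin nQ → Set
  FinitePath p ts q = (ts ≢ []) × IsPath p ts q

  intermediate : List (Fin nT) → List (Fin nQ)
  intermediate []           = []
  intermediate (t ∷ [])     = []
  intermediate (t ∷ u ∷ ts) = tgt t ∷ intermediate (u ∷ ts)

  effect : List (Fin nT) → Fin d → ℤ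
  effect []       i = ℤ.+ 0
  effect (t ∷ ts) i = eff t i ℤ.+ effect ts i

  StronglyConnected : Set
  StronglyConnected = ∀ (p q : Fin nQ) → ∃ λ ts → FinitePath p ts q

  SimpleCycle : Fin nQ → List (Fin nT) → Set
  SimpleCycle p ts = FinitePath p ts p × Unique (intermediate ts)

  Inc : (Fin d → ℤ) → Set
  Inc v = ∃ λ p → ∃ λ ts → SimpleCycle p ts × (∀ i → effect ts i ≡ v i)

  combo : List (ℚ × (Fin d → ℤ)) → Fin d → ℚ
  combo []             i = 0ℚ
  combo ((λ' , u) ∷ l) i = λ' ℚ.* toℚ (u i) ℚ.+ combo l i

  ConeInc : (Fin d → ℚ) → Set
  ConeInc w = ∃ λ (l : List (ℚ × (Fin d → ℤ))) →
                All (λ { (λ' , u) → (0ℚ ℚ.≤ λ') × Inc u }) l × (∀ i → w i ≡ combo l i)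

  -- Linear map f(p v) = c^T v + w(p)
  record LinMap : Set where
    field
      c : Fin d → ℚ
      w : Fin nQ → ℚ

  Ranked : LinMap → Fin nT → Set
  Ranked f t = dot c (eff t) ℚ.+ w (tgt t) ℚ.≤ w (src t) ℚ.- 1ℚ
    where open LinMap f

  Neutral : LinMap → Fin nT → Set
  Neutral f t = dot c (eff t) ℚ.+ w (tgt t) ≡ w (src t)
    where open LinMap f

  ranked? : (f : LinMap) → (t : Fin nT) → Dec (Ranked f t)
  ranked? f t = dot c (eff t) ℚ.+ w (tgt t) ≤? w (src t) ℚ.- 1ℚ
    where open LinMap f

  IsQRF : LinMap → Set
  IsQRF f = (∀ i → 0ℚ ℚ.≤ LinMap.c f i) × (∀ t → Ranked f t ⊎ Neutral f t)

  numRanked : LinMap → ℕ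
  numRanked f = length (filter (ranked? f) (allFin nT))

  MaximalQRF : LinMap → Set
  MaximalQRF f = IsQRF f × (∀ g → IsQRF g → numRanked g ℕ.≤ numRanked f)

{-# OPTIONS --safe #-}
module Submission where

-- By Farkas' lemma, if no w ∈ cone(Inc) makes v + w ≥ 0, there is a vector y ≥ 0 with
-- y · e ≤ 0 for the effect e of every simple cycle and y · v ≤ -1.  Since no simple cycle
-- increases y, the states carry a potential π (the largest y-weight of a simple walk) for
-- which the linear map (y, π) does not increase along any transition, and it strictly
-- decreases along some transition t of the simple cycle with effect v.  The f-drops along
-- that cycle are ≤ 0 and add up to c_f · v = 0, so t is f-neutral.  Adding (y, π) to f and
-- rescaling gives a QRF that ranks t and every f-ranked transition, contradicting the
-- maximality of f.  Farkas' lemma itself is proved by Fourier–Motzkin elimination, which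
-- tracks for each derived constraint a certificate of how it was derived.

open import Defs
open import Data.Nat using (ℕ)
open import Data.Fin using (Fin)
open import Data.Integer using (ℤ)
open import Data.Rational using (ℚ; 0ℚ; _≤_; _+_)
open import Data.Product using (∃; _×_)
open import Relation.Binary.PropositionalEquality using (_≡_)

open import Algebra.Bundles using (Ring)
open import Data.Empty using (⊥-elim)
open import Data.Fin as Fin using (zero; suc)
open import Data.Fin.Properties using (injective⇒≤)
import Data.Integer as ℤ
import Data.Integer.Properties as ℤ
open import Data.List
  using (List; []; _∷_; _++_; map; length; lookup; allFin; filter; cartesianProduct; cartesianProductWith)
open import Data.List.Membership.Propositional using (_∈_)
open import Data.List.Membership.Propositional.Properties
  using (∈-allFin; ∈-lookup; ∈-map⁺; ∈-filter⁺; ∈-filter⁻;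
         ∈-cartesianProduct⁺; ∈-cartesianProductWith⁺; ∈-cartesianProductWith⁻)
open import Data.List.Properties using (length-map)
open import Data.List.Relation.Binary.Pointwise using (Pointwise-≡⇒≡)
open import Data.List.Relation.Binary.Sublist.Heterogeneous.Properties using (toPointwise)
open import Data.List.Relation.Binary.Sublist.Propositional using (_⊆_; ⊆-refl)
open import Data.List.Relation.Binary.Sublist.Propositional.Properties using (filter⁺; length-mono-≤)
open import Data.List.Relation.Unary.All as All using (All; []; _∷_)
import Data.List.Relation.Unary.All.Properties as All
open import Data.List.Relation.Unary.Any using (here; there)
open import Data.List.Relation.Unary.Unique.Propositional using (Unique; []; _∷_)
open import Data.Nat as ℕ using (zero; suc; s≤s)
import Data.Nat.Coprimality as Coprime
import Data.Nat.Properties as ℕ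
open import Data.Product using (∃₂; _,_; proj₁; proj₂; uncurry)
open import Data.Rational
  using (mkℚ; 1ℚ; _<_; _*_; _-_; -_; 1/_; _<?_; positive; nonNegative)
import Data.Rational
open import Data.Rational.Properties
import Data.Rational.Solver as Solver
open import Data.Sum as Sum using (_⊎_; inj₁; inj₂)
open import Data.Unit using (⊤; tt)
open import Data.Vec.Functional as Vector using (Vector; zipWith) renaming (_∷_ to _∷ᵛ_)
open import Function using (_∘_; id)
open import Function.Definitions using (Injective)
open import Relation.Binary.Bundles using (DecTotalOrder)
open import Relation.Binary.Definitions using (tri<; tri≈; tri>)
open import Relation.Binary.PropositionalEquality
  using (_≢_; _≗_; refl; sym; trans; cong; cong₂; subst; subst₂; module ≡-Reasoning)
open import Relation.Nullary using (Dec; yes; no; ¬_)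
open import Relation.Nullary.Decidable using (_×-dec_)
open import Relation.Unary using (Decidable)

open import Algebra.Properties.Group +-0-group
  using (x≈y⇒x∙y⁻¹≈ε; x∙y⁻¹≈ε⇒x≈y; ⁻¹-involutive)
open import Algebra.Properties.Semiring.Sum (Ring.semiring +-*-ring)
  using (sum; sum-cong-≗; sum-replicate-zero; ∑-distrib-+; *-distribˡ-sum)
open import Data.List.Extrema (DecTotalOrder.totalOrder ≤-decTotalOrder)
  using (max; min; argmax; xs≤max; max≤v⁺; min≤xs; argmax-all; f[xs]≤f[argmax])
open Solver.+-*-Solver using (solve; _:=_; _:+_; _:*_; _:-_; :-_; con)

pos⇒invertible : ∀ {r} → 0ℚ < r → ∃ λ k → 0ℚ < k × k * r ≡ 1ℚ
pos⇒invertible {r} r>0 = 1/ r , positive⁻¹ (1/ r) {{1/pos⇒pos r}} , *-inverseˡ r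
  where
  instance
    r-positive = positive r>0
    r-nonZero = pos⇒nonZero r

neg⇒invertible : ∀ {r} → r < 0ℚ → ∃ λ k → 0ℚ < k × k * r ≡ - 1ℚ
neg⇒invertible {r} r<0 =
  let k , k>0 , k*[-r]≡1 = pos⇒invertible (neg-antimono-< r<0)
  in  k , k>0 , neg-injective (trans (neg-distribʳ-* k r) k*[-r]≡1)

p≥0∧q≥0⇒p+q≥0 : ∀ {p q} → 0ℚ ≤ p → 0ℚ ≤ q → 0ℚ ≤ p + q
p≥0∧q≥0⇒p+q≥0 {p} {q} p≥0 q≥0 = subst (_≤ p + q) (+-identityʳ 0ℚ) (+-mono-≤ p≥0 q≥0)

p≥0∧q≥0⇒p*q≥0 : ∀ {p q} → 0ℚ ≤ p → 0ℚ ≤ q → 0ℚ ≤ p * q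
p≥0∧q≥0⇒p*q≥0 {p} {q} p≥0 q≥0 =
  subst (_≤ p * q) (*-zeroʳ p) (*-monoˡ-≤-nonNeg p {{nonNegative p≥0}} q≥0)

p≤q⇒p-q≤0 : ∀ {p q} → p ≤ q → p - q ≤ 0ℚ
p≤q⇒p-q≤0 {p} {q} h = subst (p - q ≤_) (+-inverseʳ q) (+-monoˡ-≤ (- q) h)

p≤q-1⇒p-q≤-1 : ∀ {p q} → p ≤ q - 1ℚ → p - q ≤ - 1ℚ
p≤q-1⇒p-q≤-1 {p} {q} h =
  subst (p - q ≤_) (solve 1 (λ q → (q :- con 1ℚ) :- q := :- con 1ℚ) refl q) (+-monoˡ-≤ (- q) h)

p-q≤-1⇒p≤q-1 : ∀ {p q} → p - q ≤ - 1ℚ → p ≤ q - 1ℚ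
p-q≤-1⇒p≤q-1 {p} {q} h = subst₂ _≤_
  (solve 2 (λ p q → p :- q :+ q := p) refl p q)
  (solve 1 (λ q → :- con 1ℚ :+ q := q :- con 1ℚ) refl q)
  (+-monoˡ-≤ q h)

p≤r-q⇒p*1+q≤r : ∀ {p q r} → p ≤ r - q → p * 1ℚ + q ≤ r
p≤r-q⇒p*1+q≤r {p} {q} {r} h = subst₂ _≤_
  (solve 2 (λ p q → p :+ q := p :* con 1ℚ :+ q) refl p q)
  (solve 2 (λ q r → (r :- q) :+ q := r) refl q r)
  (+-monoˡ-≤ q h)

q-r≤p⇒p*-1+q≤r : ∀ {p q r} → q - r ≤ p → p * - 1ℚ + q ≤ r
q-r≤p⇒p*-1+q≤r {p} {q} {r} h = subst₂ _≤_
  (solve 2 (λ p q → (:- p) :+ q := p :* (:- con 1ℚ) :+ q) refl p q)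
  (solve 2 (λ q r → (:- (q :- r)) :+ q := r) refl q r)
  (+-monoˡ-≤ q (neg-antimono-≤ h))

q≤r⇒p*0+q≤r : ∀ {p q r} → q ≤ r → p * 0ℚ + q ≤ r
q≤r⇒p*0+q≤r {p} {q} = subst (_≤ _) (solve 2 (λ p q → q := p :* con 0ℚ :+ q) refl p q)

p+q≤r+s⇒q-s≤r-p : ∀ {p q r s} → p + q ≤ r + s → q - s ≤ r - p
p+q≤r+s⇒q-s≤r-p {p} {q} {r} {s} h = subst₂ _≤_
  (solve 4 (λ p q r s → (p :+ q) :+ (:- s :- p) := q :- s) refl p q r s)
  (solve 4 (λ p q r s → (r :+ s) :+ (:- s :- p) := r :- p) refl p q r s)
  (+-monoˡ-≤ (- s - p) h)

scaleNegatives≤-1 : ∀ (rs : List ℚ) →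
                    ∃ λ M → 0ℚ ≤ M × (∀ {r} → r ∈ rs → r < 0ℚ → M * r ≤ - 1ℚ)
scaleNegatives≤-1 rs = M , <⇒≤ M>0 , scaled
  where
  negatives = filter (_<? 0ℚ) rs
  m = argmax id (- 1ℚ) negatives
  m<0 : m < 0ℚ
  m<0 = argmax-all id {P = _< 0ℚ} (negative⁻¹ (- 1ℚ))
          (All.tabulate (proj₂ ∘ ∈-filter⁻ (_<? 0ℚ) {xs = rs}))
  M = proj₁ (neg⇒invertible m<0)
  M>0 = proj₁ (proj₂ (neg⇒invertible m<0))
  scaled : ∀ {r} → r ∈ rs → r < 0ℚ → M * r ≤ - 1ℚ
  scaled {r} r∈rs r<0 = begin
    M * r ≤⟨ *-monoˡ-≤-nonNeg M {{nonNegative (<⇒≤ M>0)}}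
               (All.lookup (f[xs]≤f[argmax] (- 1ℚ) negatives) (∈-filter⁺ (_<? 0ℚ) r∈rs r<0)) ⟩
    M * m ≡⟨ proj₂ (proj₂ (neg⇒invertible m<0)) ⟩
    - 1ℚ  ∎
    where open ≤-Reasoning

-- Farkas' lemma by Fourier–Motzkin elimination

_·_ : ∀ {n} → Vector ℚ n → Vector ℚ n → ℚ
x · a = sum (λ i → x i * a i)

·-congʳ : ∀ {n} (x : Vector ℚ n) {a a'} → a ≗ a' → x · a ≡ x · a'
·-congʳ x a≗a' = sum-cong-≗ (λ i → cong (x i *_) (a≗a' i))

·-distribˡ-+ : ∀ {n} (x a a' : Vector ℚ n) → x · zipWith _+_ a a' ≡ x · a + x · a'
·-distribˡ-+ x a a' =
  trans (sum-cong-≗ (λ i → *-distribˡ-+ (x i) (a i) (a' i)))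
        (∑-distrib-+ (λ i → x i * a i) (λ i → x i * a' i))

·-distribʳ-+ : ∀ {n} (x x' a : Vector ℚ n) → zipWith _+_ x x' · a ≡ x · a + x' · a
·-distribʳ-+ x x' a =
  trans (sum-cong-≗ (λ i → *-distribʳ-+ (a i) (x i) (x' i)))
        (∑-distrib-+ (λ i → x i * a i) (λ i → x' i * a i))

·-scaleˡ : ∀ {n} k (x a : Vector ℚ n) → Vector.map (k *_) x · a ≡ k * (x · a)
·-scaleˡ k x a = trans (sum-cong-≗ (λ i → *-assoc k (x i) (a i))) (sym (*-distribˡ-sum k (λ i → x i * a i)))

·-scaleʳ : ∀ {n} (x : Vector ℚ n) k a → x · Vector.map (k *_) a ≡ k * (x · a)
·-scaleʳ x k a =
  trans (sum-cong-≗ (λ i → x*[k*a]≡k*[x*a] (x i) (a i))) (sym (*-distribˡ-sum k (λ i → x i * a i)))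
  where
  x*[k*a]≡k*[x*a] : ∀ x a → x * (k * a) ≡ k * (x * a)
  x*[k*a]≡k*[x*a] = solve 3 (λ k x a → x :* (k :* a) := k :* (x :* a)) refl k

Constraint : ℕ → Set
Constraint n = Vector ℚ n × ℚ

_satisfies_ : ∀ {n} → Vector ℚ n → Constraint n → Set
x satisfies (a , b) = x · a ≤ b

_⊕_ : ∀ {n} → Constraint n → Constraint n → Constraint n
(a , b) ⊕ (a' , b') = zipWith _+_ a a' , b + b'

_⊛_ : ∀ {n} → ℚ → Constraint n → Constraint n
k ⊛ (a , b) = Vector.map (k *_) a , k * b

-- ≗-closed stands in for function extensionality.
record IsCone {n} (P : Constraint n → Set) : Set where
  field
    ⊕-closed : ∀ {c c'} → P c → P c' → P (c ⊕ c')
    ⊛-closed : ∀ {k c} → 0ℚ ≤ k → P c → P (k ⊛ c)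
    ≗-closed : ∀ {a a' b} → a ≗ a' → P (a , b) → P (a' , b)

Solvable : ∀ {n} → List (Constraint n) → Set
Solvable cs = ∃ λ x → All (x satisfies_) cs

Refutation : ∀ {n} → (Constraint n → Set) → Set
Refutation P = ∃₂ λ a b → P (a , b) × (∀ i → a i ≡ 0ℚ) × b < 0ℚ

lift : ∀ {n} → ℚ → Constraint n → Constraint (suc n)
lift h (a , b) = h ∷ᵛ a , b

module Elimination {n} {P : Constraint (suc n) → Set} (cone : IsCone P) where
  open IsCone cone

  P₀ : Constraint n → Set
  P₀ = P ∘ lift 0ℚ

  P₀-cone : IsCone P₀
  P₀-cone = record
    { ⊕-closed = λ p p' → ≗-closed (λ { zero → +-identityˡ 0ℚ ; (suc i) → refl }) (⊕-closed p p')
    ; ⊛-closed = λ {k} k≥0 p → ≗-closed (λ { zero → *-zeroʳ k ; (suc i) → refl }) (⊛-closed k≥0 p)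
    ; ≗-closed = λ a≗a' → ≗-closed (λ { zero → refl ; (suc i) → a≗a' i })
    }

  liftRefutation : Refutation P₀ → Refutation P
  liftRefutation (a , b , p , a≗0 , b<0) = 0ℚ ∷ᵛ a , b , p , (λ { zero → refl ; (suc i) → a≗0 i }) , b<0

  Rescaling : ℚ → Constraint n → Constraint (suc n) → Set
  Rescaling h c' c = P (lift h c') × (∀ x → x satisfies lift h c' → x satisfies c)

  data Normalised (c : Constraint (suc n)) : Set where
    upper : ∀ c' → Rescaling 1ℚ c' c → Normalised c
    lower : ∀ c' → Rescaling (- 1ℚ) c' c → Normalised c
    free  : ∀ c' → Rescaling 0ℚ c' c → Normalised c

  rescale : ∀ {a b} → P (a , b) → ∀ {k} → 0ℚ < k → ∀ h → k * a zero ≡ h →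
            Rescaling h (Vector.map (k *_) (Vector.tail a) , k * b) (a , b)
  rescale {a} {b} p {k} k>0 h k*a₀≡h = ≗-closed ka≗ (⊛-closed (<⇒≤ k>0) p) , sound
    where
    ka≗ : Vector.map (k *_) a ≗ h ∷ᵛ Vector.map (k *_) (Vector.tail a)
    ka≗ zero = k*a₀≡h
    ka≗ (suc i) = refl
    sound : ∀ x → x · (h ∷ᵛ Vector.map (k *_) (Vector.tail a)) ≤ k * b → x · a ≤ b
    sound x x·ka≤kb = *-cancelˡ-≤-pos k {{positive k>0}}
      (subst (_≤ k * b) (trans (sym (·-congʳ x ka≗)) (·-scaleʳ x k a)) x·ka≤kb)

  normalise : ∀ {c} → P c → Normalised c
  normalise {a , b} p with <-cmp (a zero) 0ℚ
  ... | tri< a₀<0 _ _ =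
    let k , k>0 , k*a₀≡-1 = neg⇒invertible a₀<0 in lower _ (rescale p k>0 (- 1ℚ) k*a₀≡-1)
  ... | tri≈ _ a₀≡0 _ = free _ (rescale p (positive⁻¹ 1ℚ) 0ℚ (trans (*-identityˡ (a zero)) a₀≡0))
  ... | tri> _ _ a₀>0 =
    let k , k>0 , k*a₀≡1 = pos⇒invertible a₀>0 in upper _ (rescale p k>0 1ℚ k*a₀≡1)

  record Split (cs : List (Constraint (suc n))) : Set where
    field
      uppers lowers frees : List (Constraint n)
      uppers-P : All (P ∘ lift 1ℚ) uppers
      lowers-P : All (P ∘ lift (- 1ℚ)) lowers
      frees-P  : All P₀ frees
      sound    : ∀ x → All ((x satisfies_) ∘ lift 1ℚ) uppers →
                       All ((x satisfies_) ∘ lift (- 1ℚ)) lowers →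
                       All ((x satisfies_) ∘ lift 0ℚ) frees → All (x satisfies_) cs
  open Split

  _◃_ : ∀ {c cs} → Normalised c → Split cs → Split (c ∷ cs)
  upper c' (p , s) ◃ S = record
    { uppers = c' ∷ uppers S ; lowers = lowers S ; frees = frees S
    ; uppers-P = p ∷ uppers-P S ; lowers-P = lowers-P S ; frees-P = frees-P S
    ; sound = λ { x (su ∷ sus) sl sf → s x su ∷ sound S x sus sl sf } }
  lower c' (p , s) ◃ S = record
    { uppers = uppers S ; lowers = c' ∷ lowers S ; frees = frees S
    ; uppers-P = uppers-P S ; lowers-P = p ∷ lowers-P S ; frees-P = frees-P S
    ; sound = λ { x su (sl ∷ sls) sf → s x sl ∷ sound S x su sls sf } }
  free c' (p , s) ◃ S = record
    { uppers = uppers S ; lowers = lowers S ; frees = c' ∷ frees S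
    ; uppers-P = uppers-P S ; lowers-P = lowers-P S ; frees-P = p ∷ frees-P S
    ; sound = λ { x su sl (sf ∷ sfs) → s x sf ∷ sound S x su sl sfs } }

  split : ∀ {cs} → All P cs → Split cs
  split [] = record
    { uppers = [] ; lowers = [] ; frees = [] ; uppers-P = [] ; lowers-P = [] ; frees-P = []
    ; sound = λ _ _ _ _ → [] }
  split (p ∷ ps) = normalise p ◃ split ps

  eliminated : ∀ {cs} → Split cs → List (Constraint n)
  eliminated S = frees S ++ cartesianProductWith _⊕_ (uppers S) (lowers S)

  eliminated-P : ∀ {cs} (S : Split cs) → All P₀ (eliminated S)
  eliminated-P S = All.++⁺ (frees-P S) (All.tabulate pair-P)
    where
    pair-P : ∀ {c} → c ∈ cartesianProductWith _⊕_ (uppers S) (lowers S) → P₀ c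
    pair-P c∈ with _ , _ , p∈ , q∈ , refl ← ∈-cartesianProductWith⁻ _⊕_ (uppers S) (lowers S) c∈ =
      ≗-closed (λ { zero → +-inverseʳ 1ℚ ; (suc i) → refl })
               (⊕-closed (All.lookup (uppers-P S) p∈) (All.lookup (lowers-P S) q∈))

  backSubstitute : ∀ {cs} (S : Split cs) → Solvable (eliminated S) → Solvable cs
  backSubstitute S (x' , sat) = x₀ ∷ᵛ x' , sound S (x₀ ∷ᵛ x')
      (All.tabulate upper-sat) (All.tabulate lower-sat) (All.map (q≤r⇒p*0+q≤r {x₀}) frees-sat)
    where
    frees-sat = proj₁ (All.++⁻ (frees S) sat)
    pairs-sat = proj₂ (All.++⁻ (frees S) sat)
    slack excess : Constraint n → ℚ
    slack (a , b) = b - x' · a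
    excess (a , b) = x' · a - b
    x₀ : ℚ
    x₀ = max (min 0ℚ (map slack (uppers S))) (map excess (lowers S))
    excess≤slack : ∀ {p q} → p ∈ uppers S → q ∈ lowers S → excess q ≤ slack p
    excess≤slack {a , b} {a' , b'} p∈ q∈ = p+q≤r+s⇒q-s≤r-p {x' · a} {x' · a'} {b} {b'}
      (subst (_≤ b + b') (·-distribˡ-+ x' a a')
             (All.lookup pairs-sat (∈-cartesianProductWith⁺ _⊕_ p∈ q∈)))
    upper-sat : ∀ {c} → c ∈ uppers S → (x₀ ∷ᵛ x') satisfies lift 1ℚ c
    upper-sat c∈ = p≤r-q⇒p*1+q≤r (max≤v⁺
      (All.lookup (All.map⁻ (min≤xs 0ℚ (map slack (uppers S)))) c∈)
      (All.map⁺ (All.tabulate (λ q∈ → excess≤slack c∈ q∈))))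
    lower-sat : ∀ {c} → c ∈ lowers S → (x₀ ∷ᵛ x') satisfies lift (- 1ℚ) c
    lower-sat c∈ = q-r≤p⇒p*-1+q≤r (All.lookup (All.map⁻ (xs≤max _ (map excess (lowers S)))) c∈)

farkas : ∀ n {P : Constraint n → Set} → IsCone P → (cs : List (Constraint n)) → All P cs →
         Solvable cs ⊎ Refutation P
farkas zero cone [] [] = inj₁ ((λ ()) , [])
farkas zero cone ((a , b) ∷ cs) (p ∷ ps) with 0ℚ ≤? b | farkas zero cone cs ps
... | no b≱0 | _                = inj₂ (a , b , p , (λ ()) , ≰⇒> b≱0)
... | yes b≥0 | inj₁ (x , sat) = inj₁ (x , b≥0 ∷ sat)
... | yes _ | inj₂ refutation   = inj₂ refutation
farkas (suc n) cone cs ps =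
  Sum.map (backSubstitute S) liftRefutation (farkas n P₀-cone (eliminated S) (eliminated-P S))
  where
  open Elimination cone
  S = split ps

Unique⇒lookup-injective : ∀ {X : Set} {xs : List X} → Unique xs → Injective _≡_ _≡_ (lookup xs)
Unique⇒lookup-injective (x∉xs ∷ _) {zero} {zero} _ = refl
Unique⇒lookup-injective (x∉xs ∷ _) {zero} {suc j} x≡xⱼ = ⊥-elim (All.lookup x∉xs (∈-lookup j) x≡xⱼ)
Unique⇒lookup-injective (x∉xs ∷ _) {suc i} {zero} xᵢ≡x =
  ⊥-elim (All.lookup x∉xs (∈-lookup i) (sym xᵢ≡x))
Unique⇒lookup-injective (_ ∷ xs!) {suc i} {suc j} xᵢ≡xⱼ = cong suc (Unique⇒lookup-injective xs! xᵢ≡xⱼ)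

Unique⇒length≤ : ∀ {n} {xs : List (Fin n)} → Unique xs → length xs ℕ.≤ n
Unique⇒length≤ xs! = injective⇒≤ (Unique⇒lookup-injective xs!)

Unique-++⁻ : ∀ {X : Set} (xs : List X) {ys} → Unique (xs ++ ys) → Unique xs × Unique ys
Unique-++⁻ [] ys! = [] , ys!
Unique-++⁻ (x ∷ xs) (x∉ ∷ xs++ys!) =
  proj₁ (All.++⁻ xs x∉) ∷ proj₁ (Unique-++⁻ xs xs++ys!) , proj₂ (Unique-++⁻ xs xs++ys!)

listsUpTo : ∀ m → ℕ → List (List (Fin m))
listsUpTo m zero = [] ∷ []
listsUpTo m (suc L) = [] ∷ cartesianProductWith _∷_ (allFin m) (listsUpTo m L)

∈-listsUpTo : ∀ {m} L (xs : List (Fin m)) → length xs ℕ.≤ L → xs ∈ listsUpTo m L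
∈-listsUpTo zero [] _ = here refl
∈-listsUpTo (suc L) [] _ = here refl
∈-listsUpTo (suc L) (x ∷ xs) (s≤s |xs|≤L) =
  there (∈-cartesianProductWith⁺ _∷_ (∈-allFin x) (∈-listsUpTo L xs |xs|≤L))

length-filter-< : ∀ {X : Set} {P Q : X → Set} (P? : Decidable P) (Q? : Decidable Q) →
                  (∀ {x} → P x → Q x) → ∀ {x xs} → x ∈ xs → Q x → ¬ P x →
                  length (filter P? xs) ℕ.< length (filter Q? xs)
length-filter-< P? Q? P⇒Q {x} {xs} x∈xs Qx ¬Px = ℕ.≤∧≢⇒< (length-mono-≤ P⊆Q) λ same-length →
  ¬Px (proj₂ (∈-filter⁻ P? {xs = xs} (subst (x ∈_) (sym (Pointwise-≡⇒≡ (toPointwise same-length P⊆Q)))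
                                                (∈-filter⁺ Q? x∈xs Qx))))
  where
  P⊆Q : filter P? xs ⊆ filter Q? xs
  P⊆Q = filter⁺ P? Q? (λ { refl → P⇒Q }) (⊆-refl {x = xs})

sumOf : ∀ {X : Set} → (X → ℚ) → List X → ℚ
sumOf D [] = 0ℚ
sumOf D (x ∷ xs) = D x + sumOf D xs

module _ {X : Set} {D : X → ℚ} where

  sumOf≤0 : (∀ x → D x ≤ 0ℚ) → ∀ xs → sumOf D xs ≤ 0ℚ
  sumOf≤0 D≤0 [] = ≤-refl
  sumOf≤0 D≤0 (x ∷ xs) =
    subst (sumOf D (x ∷ xs) ≤_) (+-identityʳ 0ℚ) (+-mono-≤ (D≤0 x) (sumOf≤0 D≤0 xs))

  sumOf≤member : (∀ x → D x ≤ 0ℚ) → ∀ {x xs} → x ∈ xs → sumOf D xs ≤ D x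
  sumOf≤member D≤0 {x} {_ ∷ xs} (here refl) =
    subst (sumOf D (x ∷ xs) ≤_) (+-identityʳ (D x)) (+-monoʳ-≤ (D x) (sumOf≤0 D≤0 xs))
  sumOf≤member D≤0 {x} {x' ∷ xs} (there x∈xs) =
    ≤-trans (+-monoˡ-≤ (sumOf D xs) (D≤0 x'))
            (subst (_≤ D x) (sym (+-identityˡ (sumOf D xs))) (sumOf≤member D≤0 x∈xs))

  sumOf<0⇒member<0 : ∀ xs → sumOf D xs < 0ℚ → ∃ λ x → x ∈ xs × D x < 0ℚ
  sumOf<0⇒member<0 [] 0<0 = ⊥-elim (<-irrefl refl 0<0)
  sumOf<0⇒member<0 (x ∷ xs) sum<0 with D x <? 0ℚ
  ... | yes Dx<0 = x , here refl , Dx<0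
  ... | no Dx≮0 =
    let x' , x'∈xs , Dx'<0 = sumOf<0⇒member<0 xs
          (≤-<-trans (subst (_≤ sumOf D (x ∷ xs)) (+-identityˡ (sumOf D xs))
                            (+-monoˡ-≤ (sumOf D xs) (≮⇒≥ Dx≮0)))
                     sum<0)
    in  x' , there x'∈xs , Dx'<0

sumℚ≡sum : ∀ n (f : Vector ℚ n) → sumℚ n f ≡ sum f
sumℚ≡sum zero f = refl
sumℚ≡sum (suc n) f = cong (f zero +_) (sumℚ≡sum n (f ∘ suc))

toℚ≡mkℚ : ∀ z → toℚ z ≡ mkℚ z 0 (Coprime.sym (Coprime.1-coprimeTo ℤ.∣ z ∣))
toℚ≡mkℚ z = ↥p/↧p≡p (mkℚ z 0 (Coprime.sym (Coprime.1-coprimeTo ℤ.∣ z ∣)))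

toℚ-+ : ∀ a b → toℚ (a ℤ.+ b) ≡ toℚ a + toℚ b
toℚ-+ a b rewrite toℚ≡mkℚ a | toℚ≡mkℚ b =
  cong₂ (λ a' b' → (a' ℤ.+ b') Data.Rational./ 1) (sym (ℤ.*-identityʳ a)) (sym (ℤ.*-identityʳ b))

dot≡· : ∀ {d} (c : Vector ℚ d) u → dot c u ≡ c · (toℚ ∘ u)
dot≡· {d} c u = sumℚ≡sum d _

dot-congʳ : ∀ {d} (c : Vector ℚ d) {u v} → u ≗ v → dot c u ≡ dot c v
dot-congʳ c {u} {v} u≗v = trans (dot≡· c u) (trans (·-congʳ c (cong toℚ ∘ u≗v)) (sym (dot≡· c v)))

dot-zeroʳ : ∀ {d} (c : Vector ℚ d) → dot c (λ _ → ℤ.+ 0) ≡ 0ℚ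
dot-zeroʳ {d} c =
  trans (dot≡· c (λ _ → ℤ.+ 0)) (trans (sum-cong-≗ (λ i → *-zeroʳ (c i))) (sum-replicate-zero d))

dot-distribʳ-+ : ∀ {d} (c : Vector ℚ d) u v → dot c (λ i → u i ℤ.+ v i) ≡ dot c u + dot c v
dot-distribʳ-+ c u v = begin
  dot c (λ i → u i ℤ.+ v i)               ≡⟨ dot≡· c (λ i → u i ℤ.+ v i) ⟩
  c · (λ i → toℚ (u i ℤ.+ v i))           ≡⟨ ·-congʳ c (λ i → toℚ-+ (u i) (v i)) ⟩
  c · zipWith _+_ (toℚ ∘ u) (toℚ ∘ v)     ≡⟨ ·-distribˡ-+ c (toℚ ∘ u) (toℚ ∘ v) ⟩
  c · (toℚ ∘ u) + c · (toℚ ∘ v)           ≡⟨ sym (cong₂ _+_ (dot≡· c u) (dot≡· c v)) ⟩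
  dot c u + dot c v                       ∎
  where open ≡-Reasoning

dot-distribˡ-+ : ∀ {d} (c c' : Vector ℚ d) u → dot (zipWith _+_ c c') u ≡ dot c u + dot c' u
dot-distribˡ-+ c c' u = trans (dot≡· (zipWith _+_ c c') u)
  (trans (·-distribʳ-+ c c' (toℚ ∘ u)) (sym (cong₂ _+_ (dot≡· c u) (dot≡· c' u))))

dot-scaleˡ : ∀ {d} k (c : Vector ℚ d) u → dot (Vector.map (k *_) c) u ≡ k * dot c u
dot-scaleˡ k c u = trans (dot≡· (Vector.map (k *_) c) u)
  (trans (·-scaleˡ k c (toℚ ∘ u)) (cong (k *_) (sym (dot≡· c u))))

module Walks {d} (A : VASS d) where
  open VASS A
  open import Data.List.Relation.Unary.Unique.DecPropositional (Fin._≟_ {nQ}) using (unique?)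

  Walk : Fin nQ → List (Fin nT) → Set
  Walk p [] = ⊤
  Walk p (t ∷ ts) = src t ≡ p × Walk (tgt t) ts

  walk? : ∀ p ts → Dec (Walk p ts)
  walk? p [] = yes tt
  walk? p (t ∷ ts) = (src t Fin.≟ p) ×-dec walk? (tgt t) ts

  visited : Fin nQ → List (Fin nT) → List (Fin nQ)
  visited p ts = p ∷ map tgt ts

  visitedBefore : Fin nQ → List (Fin nT) → List (Fin nQ)
  visitedBefore p [] = []
  visitedBefore p (t ∷ ts) = p ∷ visitedBefore (tgt t) ts

  intermediate≡visitedBefore : ∀ t ts → intermediate A (t ∷ ts) ≡ visitedBefore (tgt t) ts
  intermediate≡visitedBefore t [] = refl
  intermediate≡visitedBefore t (u ∷ ts) = cong (tgt t ∷_) (intermediate≡visitedBefore u ts)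

  SimpleWalk : Fin nQ → List (Fin nT) → Set
  SimpleWalk p ts = Walk p ts × Unique (visited p ts)

  simpleWalk? : ∀ p ts → Dec (SimpleWalk p ts)
  simpleWalk? p ts = walk? p ts ×-dec unique? (visited p ts)

  simpleWalks : Fin nQ → List (List (Fin nT))
  simpleWalks p = filter (simpleWalk? p) (listsUpTo nT nQ)

  ∈-simpleWalks : ∀ {p ts} → SimpleWalk p ts → ts ∈ simpleWalks p
  ∈-simpleWalks {p} {ts} sw@(_ , visited!) = ∈-filter⁺ (simpleWalk? p)
    (∈-listsUpTo nQ ts
      (ℕ.<⇒≤ (subst (ℕ._≤ nQ) (cong suc (length-map tgt ts)) (Unique⇒length≤ visited!))))
    sw

  simpleWalks-simple : ∀ {p ts} → ts ∈ simpleWalks p → SimpleWalk p ts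
  simpleWalks-simple {p} = proj₂ ∘ ∈-filter⁻ (simpleWalk? p) {xs = listsUpTo nT nQ}

  isPath? : ∀ p ts q → Dec (IsPath A p ts q)
  isPath? p [] q = p Fin.≟ q
  isPath? p (t ∷ ts) q = (src t Fin.≟ p) ×-dec isPath? (tgt t) ts q

  simpleCycle? : ∀ p ts → Dec (SimpleCycle A p ts)
  simpleCycle? p ts = (nonEmpty? ts ×-dec isPath? p ts p) ×-dec unique? (intermediate A ts)
    where
    nonEmpty? : (ts : List (Fin nT)) → Dec (ts ≢ [])
    nonEmpty? [] = no (λ []≢[] → []≢[] refl)
    nonEmpty? (_ ∷ _) = yes (λ ())

  length≤1+length-intermediate : ∀ ts → length ts ℕ.≤ suc (length (intermediate A ts))
  length≤1+length-intermediate [] = ℕ.z≤n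
  length≤1+length-intermediate (t ∷ []) = ℕ.≤-refl
  length≤1+length-intermediate (t ∷ u ∷ ts) = s≤s (length≤1+length-intermediate (u ∷ ts))

  cycleCandidates : List (Fin nQ × List (Fin nT))
  cycleCandidates = cartesianProduct (allFin nQ) (listsUpTo nT (suc nQ))

  simpleCycles : List (Fin nQ × List (Fin nT))
  simpleCycles = filter (uncurry simpleCycle?) cycleCandidates

  ∈-simpleCycles : ∀ {p ts} → SimpleCycle A p ts → (p , ts) ∈ simpleCycles
  ∈-simpleCycles {p} {ts} sc@(_ , intermediate!) = ∈-filter⁺ (uncurry simpleCycle?)
    (∈-cartesianProduct⁺ (∈-allFin p) (∈-listsUpTo (suc nQ) ts
      (ℕ.≤-trans (length≤1+length-intermediate ts) (s≤s (Unique⇒length≤ intermediate!)))))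
    sc

  simpleCycles-simple : ∀ {p ts} → (p , ts) ∈ simpleCycles → SimpleCycle A p ts
  simpleCycles-simple = proj₂ ∘ ∈-filter⁻ (uncurry simpleCycle?) {xs = cycleCandidates}

  effect-++ : ∀ xs ys i → effect A (xs ++ ys) i ≡ effect A xs i ℤ.+ effect A ys i
  effect-++ [] ys i = sym (ℤ.+-identityˡ _)
  effect-++ (x ∷ xs) ys i =
    trans (cong (λ z → eff x i ℤ.+ z) (effect-++ xs ys i)) (sym (ℤ.+-assoc (eff x i) _ _))

  splitWalk : ∀ {q x} P → Walk q P → x ∈ visited q P →
              ∃₂ λ P₁ P₂ → P ≡ P₁ ++ P₂ × IsPath A q P₁ x × Walk x P₂ ×
                           visited q P ≡ visitedBefore q P₁ ++ visited x P₂
  splitWalk P w (here refl) = [] , P , refl , refl , w , refl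
  splitWalk (t ∷ P) (refl , w) (there x∈) with P₁ , P₂ , refl , path , w₂ , eq ← splitWalk P w x∈ =
    t ∷ P₁ , P₂ , refl , (refl , path) , w₂ , cong (_ ∷_) eq

-- Potentials

module Potential {d} (A : VASS d) (y : Vector ℚ d)
                 (cycles≤0 : ∀ {p ts} → SimpleCycle A p ts → dot y (effect A ts) ≤ 0ℚ) where
  open VASS A
  open Walks A
  open import Data.List.Membership.DecPropositional (Fin._≟_ {nQ}) using (_∈?_)

  weight : List (Fin nT) → ℚ
  weight ts = dot y (effect A ts)

  weight-∷ : ∀ t ts → weight (t ∷ ts) ≡ dot y (eff t) + weight ts
  weight-∷ t ts = dot-distribʳ-+ y (eff t) (effect A ts)

  weight-++ : ∀ P₁ P₂ → weight (P₁ ++ P₂) ≡ weight P₁ + weight P₂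
  weight-++ P₁ P₂ = trans (dot-congʳ y (effect-++ P₁ P₂)) (dot-distribʳ-+ y (effect A P₁) (effect A P₂))

  heaviest : Fin nQ → List (Fin nT)
  heaviest p = argmax weight [] (simpleWalks p)

  π : Fin nQ → ℚ
  π p = weight (heaviest p)

  heaviest-simple : ∀ p → SimpleWalk p (heaviest p)
  heaviest-simple p = argmax-all weight {P = SimpleWalk p} (tt , [] ∷ []) (All.tabulate simpleWalks-simple)

  weight≤π : ∀ {p P} → SimpleWalk p P → weight P ≤ π p
  weight≤π {p} sw = All.lookup (f[xs]≤f[argmax] [] (simpleWalks p)) (∈-simpleWalks sw)

  -- Either t extends the heaviest simple walk P from tgt t to a simple walk, or t closes a
  -- simple cycle with a prefix of P and the rest of P is a simple walk from src t.
  π-nonincreasing : ∀ t → dot y (eff t) + π (tgt t) ≤ π (src t)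
  π-nonincreasing t with walk , visited! ← heaviest-simple (tgt t) | src t ∈? visited (tgt t) (heaviest (tgt t))
  ... | no src∉ = subst (_≤ π (src t)) (weight-∷ t (heaviest (tgt t)))
                        (weight≤π ((refl , walk) , All.¬Any⇒All¬ _ src∉ ∷ visited!))
  ... | yes src∈ with P₁ , P₂ , P≡P₁++P₂ , path , walk₂ , visited≡ ← splitWalk _ walk src∈ = begin
      dot y (eff t) + π (tgt t)
        ≡⟨ cong (λ P → dot y (eff t) + weight P) P≡P₁++P₂ ⟩
      dot y (eff t) + weight (P₁ ++ P₂)
        ≡⟨ cong (dot y (eff t) +_) (weight-++ P₁ P₂) ⟩
      dot y (eff t) + (weight P₁ + weight P₂)
        ≡⟨ sym (+-assoc (dot y (eff t)) (weight P₁) (weight P₂)) ⟩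
      dot y (eff t) + weight P₁ + weight P₂
        ≡⟨ cong (_+ weight P₂) (sym (weight-∷ t P₁)) ⟩
      weight (t ∷ P₁) + weight P₂
        ≤⟨ +-mono-≤ (cycles≤0 cycle) (weight≤π (walk₂ , proj₂ uniques)) ⟩
      0ℚ + π (src t)
        ≡⟨ +-identityˡ (π (src t)) ⟩
      π (src t)
        ∎
    where
    open ≤-Reasoning
    uniques = Unique-++⁻ (visitedBefore (tgt t) P₁) (subst Unique visited≡ visited!)
    cycle : SimpleCycle A (src t) (t ∷ P₁)
    cycle = ((λ ()) , refl , path) , subst Unique (sym (intermediate≡visitedBefore t P₁)) (proj₁ uniques)

nonpositiveCycles⇒potential : ∀ {d} (A : VASS d) y →
                              (∀ {p ts} → SimpleCycle A p ts → dot y (effect A ts) ≤ 0ℚ) →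
                              ∃ λ π → ∀ t → dot y (VASS.eff A t) + π (VASS.tgt A t) ≤ π (VASS.src A t)
nonpositiveCycles⇒potential A y cycles≤0 = π , π-nonincreasing
  where open Potential A y cycles≤0

-- Linear maps and their drops along transitions

module Drops {d} (A : VASS d) where
  open VASS A
  open LinMap

  drop : LinMap A → Fin nT → ℚ
  drop f t = dot (c f) (eff t) + w f (tgt t) - w f (src t)

  Ranked⇒drop≤-1 : ∀ {f t} → Ranked A f t → drop f t ≤ - 1ℚ
  Ranked⇒drop≤-1 = p≤q-1⇒p-q≤-1

  drop≤-1⇒Ranked : ∀ {f t} → drop f t ≤ - 1ℚ → Ranked A f t
  drop≤-1⇒Ranked = p-q≤-1⇒p≤q-1

  Neutral⇒drop≡0 : ∀ {f t} → Neutral A f t → drop f t ≡ 0ℚ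
  Neutral⇒drop≡0 = x≈y⇒x∙y⁻¹≈ε

  drop≡0⇒Neutral : ∀ {f t} → drop f t ≡ 0ℚ → Neutral A f t
  drop≡0⇒Neutral = x∙y⁻¹≈ε⇒x≈y _ _

  QRF⇒drop≤0 : ∀ {f} → IsQRF A f → ∀ t → drop f t ≤ 0ℚ
  QRF⇒drop≤0 {f} (_ , ranked-or-neutral) t with ranked-or-neutral t
  ... | inj₁ ranked = ≤-trans (Ranked⇒drop≤-1 {f} {t} ranked) (<⇒≤ (negative⁻¹ (- 1ℚ)))
  ... | inj₂ neutral = ≤-reflexive (Neutral⇒drop≡0 {f} {t} neutral)

  _⊞_ : LinMap A → LinMap A → LinMap A
  f ⊞ g = record { c = zipWith _+_ (c f) (c g) ; w = zipWith _+_ (w f) (w g) }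

  _⊠_ : ℚ → LinMap A → LinMap A
  k ⊠ f = record { c = Vector.map (k *_) (c f) ; w = Vector.map (k *_) (w f) }

  drop-⊞ : ∀ f g t → drop (f ⊞ g) t ≡ drop f t + drop g t
  drop-⊞ f g t rewrite dot-distribˡ-+ (c f) (c g) (eff t) =
    solve 6 (λ x x' a a' b b' → (x :+ x') :+ (a :+ a') :- (b :+ b') := (x :+ a :- b) :+ (x' :+ a' :- b')) refl
      (dot (c f) (eff t)) (dot (c g) (eff t)) (w f (tgt t)) (w g (tgt t)) (w f (src t)) (w g (src t))

  drop-⊠ : ∀ k f t → drop (k ⊠ f) t ≡ k * drop f t
  drop-⊠ k f t rewrite dot-scaleˡ k (c f) (eff t) =
    solve 4 (λ k x a b → k :* x :+ k :* a :- k :* b := k :* (x :+ a :- b)) refl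
      k (dot (c f) (eff t)) (w f (tgt t)) (w f (src t))

  sumOf-drop : ∀ f {p ts q} → IsPath A p ts q → sumOf (drop f) ts ≡ dot (c f) (effect A ts) + w f q - w f p
  sumOf-drop f {p} {[]} refl = begin
    0ℚ                                      ≡⟨ solve 1 (λ a → con 0ℚ := con 0ℚ :+ a :- a) refl (w f p) ⟩
    0ℚ + w f p - w f p                      ≡⟨ cong (λ x → x + w f p - w f p) (sym (dot-zeroʳ (c f))) ⟩
    dot (c f) (effect A []) + w f p - w f p ∎
    where open ≡-Reasoning
  sumOf-drop f {ts = t ∷ ts} {q} (refl , path)
    rewrite sumOf-drop f path | dot-distribʳ-+ (c f) (eff t) (effect A ts) =
    solve 5 (λ x y a b c → (x :+ b :- c) :+ (y :+ a :- b) := (x :+ y) :+ a :- c) refl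
      (dot (c f) (eff t)) (dot (c f) (effect A ts)) (w f q) (w f (tgt t)) (w f (src t))

  sumOf-drop-cycle : ∀ f {p ts} → IsPath A p ts p → sumOf (drop f) ts ≡ dot (c f) (effect A ts)
  sumOf-drop-cycle f {p} {ts} cycle = trans (sumOf-drop f cycle)
    (solve 2 (λ x a → x :+ a :- a := x) refl (dot (c f) (effect A ts)) (w f p))

  balancedCycle⇒unranked : ∀ {f p ts} → IsQRF A f → IsPath A p ts p → dot (c f) (effect A ts) ≡ 0ℚ →
                           ∀ {t} → t ∈ ts → ¬ Ranked A f t
  balancedCycle⇒unranked {f} f-QRF cycle c·e≡0 {t} t∈ts ranked = <-irrefl refl (≤-<-trans
    (subst (_≤ drop f t) (trans (sumOf-drop-cycle f cycle) c·e≡0)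
           (sumOf≤member (QRF⇒drop≤0 {f} f-QRF) t∈ts))
    (≤-<-trans (Ranked⇒drop≤-1 {f} {t} ranked) (negative⁻¹ (- 1ℚ))))

  decreasingCycle⇒drop<0 : ∀ f {p ts} → IsPath A p ts p → dot (c f) (effect A ts) < 0ℚ →
                           ∃ λ t → t ∈ ts × drop f t < 0ℚ
  decreasingCycle⇒drop<0 f {ts = ts} cycle c·e<0 =
    sumOf<0⇒member<0 ts (subst (_< 0ℚ) (sym (sumOf-drop-cycle f cycle)) c·e<0)

  nonincreasing⇒QRF : ∀ h → (∀ i → 0ℚ ≤ c h i) → (∀ t → drop h t ≤ 0ℚ) →
                      ∃ λ g → IsQRF A g × (∀ t → drop h t < 0ℚ → Ranked A g t)
  nonincreasing⇒QRF h c≥0 drop≤0 =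
    M ⊠ h , ((λ i → p≥0∧q≥0⇒p*q≥0 M≥0 (c≥0 i)) , ranked-or-neutral) , ranked
    where
    scaling = scaleNegatives≤-1 (map (drop h) (allFin nT))
    M = proj₁ scaling
    M≥0 = proj₁ (proj₂ scaling)
    ranked : ∀ t → drop h t < 0ℚ → Ranked A (M ⊠ h) t
    ranked t drop<0 = drop≤-1⇒Ranked {M ⊠ h} {t}
      (subst (_≤ - 1ℚ) (sym (drop-⊠ M h t))
             (proj₂ (proj₂ scaling) (∈-map⁺ (drop h) (∈-allFin t)) drop<0))
    ranked-or-neutral : ∀ t → Ranked A (M ⊠ h) t ⊎ Neutral A (M ⊠ h) t
    ranked-or-neutral t with <-cmp (drop h t) 0ℚ
    ... | tri< drop<0 _ _ = inj₁ (ranked t drop<0)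
    ... | tri≈ _ drop≡0 _ =
      inj₂ (drop≡0⇒Neutral {M ⊠ h} {t} (trans (drop-⊠ M h t) (trans (cong (M *_) drop≡0) (*-zeroʳ M))))
    ... | tri> _ _ drop>0 = ⊥-elim (<-irrefl refl (<-≤-trans drop>0 (drop≤0 t)))

  QRF⊞nonincreasing : ∀ {f k} → IsQRF A f → (∀ i → 0ℚ ≤ c k i) → (∀ t → drop k t ≤ 0ℚ) →
                      ∀ {t*} → drop k t* < 0ℚ → ¬ Ranked A f t* →
                      ∃ λ g → IsQRF A g × numRanked A f ℕ.< numRanked A g
  QRF⊞nonincreasing {f} {k} f-QRF k-normal≥0 k-drop≤0 {t*} k-drop[t*]<0 t*-unranked =
    g , g-QRF , length-filter-< (ranked? A f) (ranked? A g) f-ranked⇒g-ranked (∈-allFin t*) t*-ranked t*-unranked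
    where
    h-drop≤0 : ∀ t → drop (f ⊞ k) t ≤ 0ℚ
    h-drop≤0 t = subst (_≤ 0ℚ) (sym (drop-⊞ f k t))
      (subst (drop f t + drop k t ≤_) (+-identityʳ 0ℚ) (+-mono-≤ (QRF⇒drop≤0 {f} f-QRF t) (k-drop≤0 t)))
    improved =
      nonincreasing⇒QRF (f ⊞ k) (λ i → p≥0∧q≥0⇒p+q≥0 (proj₁ f-QRF i) (k-normal≥0 i)) h-drop≤0
    g = proj₁ improved
    g-QRF = proj₁ (proj₂ improved)
    g-ranked = proj₂ (proj₂ improved)
    t*-ranked : Ranked A g t*
    t*-ranked = g-ranked t* (subst (_< 0ℚ) (sym (drop-⊞ f k t*))
      (subst (drop f t* + drop k t* <_) (+-identityˡ 0ℚ) (+-mono-≤-< (QRF⇒drop≤0 {f} f-QRF t*) k-drop[t*]<0)))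
    f-ranked⇒g-ranked : ∀ {t} → Ranked A f t → Ranked A g t
    f-ranked⇒g-ranked {t} ranked = g-ranked t (subst (_< 0ℚ) (sym (drop-⊞ f k t))
      (≤-<-trans (+-mono-≤ (Ranked⇒drop≤-1 {f} {t} ranked) (k-drop≤0 t)) (negative⁻¹ (- 1ℚ + 0ℚ))))

maximalQRF⇒noSeparatingVector :
  ∀ {d} (A : VASS d) f → MaximalQRF A f → ∀ v → Inc A v → dot (LinMap.c f) v ≡ 0ℚ →
  ∀ y → (∀ i → 0ℚ ≤ y i) → (∀ {p ts} → SimpleCycle A p ts → dot y (effect A ts) ≤ 0ℚ) →
  ¬ (dot y v ≤ - 1ℚ)
maximalQRF⇒noSeparatingVector A f (f-QRF , f-max) v (_ , ts , ((_ , cycle) , _) , effect≗v) c·v≡0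
                              y y≥0 cycles≤0 y·v≤-1 =
  let π , π-nonincreasing = nonpositiveCycles⇒potential A y cycles≤0
      yπ : LinMap A
      yπ = record { c = y ; w = π }
      y·e<0 = ≤-<-trans (subst (_≤ - 1ℚ) (sym (dot-congʳ y effect≗v)) y·v≤-1) (negative⁻¹ (- 1ℚ))
      t , t∈ts , yπ-drop[t]<0 = decreasingCycle⇒drop<0 yπ cycle y·e<0
      t-unranked = balancedCycle⇒unranked {f} f-QRF cycle (trans (dot-congʳ (LinMap.c f) effect≗v) c·v≡0) t∈ts
      g , g-QRF , f<g =
        QRF⊞nonincreasing {f} {yπ} f-QRF y≥0 (p≤q⇒p-q≤0 ∘ π-nonincreasing) yπ-drop[t]<0 t-unranked
  in  ℕ.<⇒≱ f<g (f-max g g-QRF)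
  where open Drops A

-- The dual system

module _ {d} (A : VASS d) where

  combo-++ : ∀ l l' i → combo A (l ++ l') i ≡ combo A l i + combo A l' i
  combo-++ [] l' i = sym (+-identityˡ _)
  combo-++ ((λ' , u) ∷ l) l' i rewrite combo-++ l l' i = sym (+-assoc (λ' * toℚ (u i)) _ _)

  scaleCombo : ℚ → List (ℚ × (Fin d → ℤ)) → List (ℚ × (Fin d → ℤ))
  scaleCombo k = map (λ (λ' , u) → k * λ' , u)

  combo-scale : ∀ k l i → combo A (scaleCombo k l) i ≡ k * combo A l i
  combo-scale k [] i = sym (*-zeroʳ k)
  combo-scale k ((λ' , u) ∷ l) i rewrite combo-scale k l i =
    solve 4 (λ k λ' x c → k :* λ' :* x :+ k :* c := k :* (λ' :* x :+ c)) refl k λ' (toℚ (u i)) (combo A l i)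

  ConeInc-0 : ConeInc A (λ _ → 0ℚ)
  ConeInc-0 = [] , [] , λ _ → refl

  ConeInc-+ : ∀ {w w'} → ConeInc A w → ConeInc A w' → ConeInc A (zipWith _+_ w w')
  ConeInc-+ (l , l-ok , w≗l) (l' , l'-ok , w'≗l') =
    l ++ l' , All.++⁺ l-ok l'-ok , λ i → trans (cong₂ _+_ (w≗l i) (w'≗l' i)) (sym (combo-++ l l' i))

  ConeInc-* : ∀ {k w} → 0ℚ ≤ k → ConeInc A w → ConeInc A (Vector.map (k *_) w)
  ConeInc-* {k} k≥0 (l , l-ok , w≗l) =
    scaleCombo k l ,
    All.map⁺ (All.map (λ (λ'≥0 , u∈Inc) → p≥0∧q≥0⇒p*q≥0 k≥0 λ'≥0 , u∈Inc) l-ok) ,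
    λ i → trans (cong (k *_) (w≗l i)) (sym (combo-scale k l i))

  Inc⇒ConeInc : ∀ {u} → Inc A u → ConeInc A (toℚ ∘ u)
  Inc⇒ConeInc {u} u∈Inc =
    (1ℚ , u) ∷ [] , (<⇒≤ (positive⁻¹ 1ℚ) , u∈Inc) ∷ [] ,
    λ i → solve 1 (λ x → x := con 1ℚ :* x :+ con 0ℚ) refl (toℚ (u i))

negUnit : ∀ {n} → Fin n → Vector ℚ n
negUnit zero = - 1ℚ ∷ᵛ (λ _ → 0ℚ)
negUnit (suc i) = 0ℚ ∷ᵛ negUnit i

negUnit≤0 : ∀ {n} (i j : Fin n) → negUnit i j ≤ 0ℚ
negUnit≤0 zero zero = <⇒≤ (negative⁻¹ (- 1ℚ))
negUnit≤0 zero (suc j) = ≤-refl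
negUnit≤0 (suc i) zero = ≤-refl
negUnit≤0 (suc i) (suc j) = negUnit≤0 i j

·-negUnit : ∀ {n} (x : Vector ℚ n) i → x · negUnit i ≡ - x i
·-negUnit {suc n} x zero = begin
  x zero * - 1ℚ + sum (λ j → x (suc j) * 0ℚ)
    ≡⟨ cong (x zero * - 1ℚ +_) (trans (sum-cong-≗ (λ j → *-zeroʳ (x (suc j)))) (sum-replicate-zero n)) ⟩
  x zero * - 1ℚ + 0ℚ
    ≡⟨ solve 1 (λ a → a :* (:- con 1ℚ) :+ con 0ℚ := :- a) refl (x zero) ⟩
  - x zero ∎
  where open ≡-Reasoning
·-negUnit x (suc i) = trans (cong (x zero * 0ℚ +_) (·-negUnit (x ∘ suc) i))
  (solve 2 (λ a b → a :* con 0ℚ :+ (:- b) := :- b) refl (x zero) (x (suc i)))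

module DualSystem {d} (A : VASS d) (v : Fin d → ℤ) where
  open Walks A

  v̂ : Vector ℚ d
  v̂ = toℚ ∘ v

  -- Nonnegative combinations of `system`; the nonnegativity rows let the normal drop below w + ν v̂.
  Derivable : Constraint d → Set
  Derivable (a , b) = ∃₂ λ ν w → 0ℚ ≤ ν × ConeInc A w × b ≡ - ν × (∀ i → a i ≤ w i + ν * v̂ i)

  Derivable-cone : IsCone Derivable
  Derivable-cone = record
    { ⊕-closed = λ (ν , w , ν≥0 , w∈ , b≡-ν , a≤) (ν' , w' , ν'≥0 , w'∈ , b'≡-ν' , a'≤) →
        ν + ν' , zipWith _+_ w w' , p≥0∧q≥0⇒p+q≥0 ν≥0 ν'≥0 , ConeInc-+ A w∈ w'∈ ,
        trans (cong₂ _+_ b≡-ν b'≡-ν') (sym (neg-distrib-+ ν ν')) ,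
        λ i → subst (_ ≤_)
          (solve 5 (λ w w' ν ν' x → (w :+ ν :* x) :+ (w' :+ ν' :* x) := (w :+ w') :+ (ν :+ ν') :* x) refl
             (w i) (w' i) ν ν' (v̂ i))
          (+-mono-≤ (a≤ i) (a'≤ i))
    ; ⊛-closed = λ {k} k≥0 (ν , w , ν≥0 , w∈ , b≡-ν , a≤) →
        k * ν , Vector.map (k *_) w , p≥0∧q≥0⇒p*q≥0 k≥0 ν≥0 , ConeInc-* A k≥0 w∈ ,
        trans (cong (k *_) b≡-ν) (sym (neg-distribʳ-* k ν)) ,
        λ i → subst (_ ≤_)
          (solve 4 (λ k w ν x → k :* (w :+ ν :* x) := k :* w :+ (k :* ν) :* x) refl k (w i) ν (v̂ i))
          (*-monoˡ-≤-nonNeg k {{nonNegative k≥0}} (a≤ i))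
    ; ≗-closed = λ a≗a' (ν , w , ν≥0 , w∈ , b≡-ν , a≤) →
        ν , w , ν≥0 , w∈ , b≡-ν , λ i → subst (_≤ w i + ν * v̂ i) (a≗a' i) (a≤ i)
    }

  nonnegativity cycleConstraints system : List (Constraint d)
  nonnegativity = map (λ i → negUnit i , 0ℚ) (allFin d)
  cycleConstraints = map (λ (_ , ts) → toℚ ∘ effect A ts , 0ℚ) simpleCycles
  system = nonnegativity ++ cycleConstraints ++ (v̂ , - 1ℚ) ∷ []

  system-derivable : All Derivable system
  system-derivable = All.++⁺ nonnegativity-derivable (All.++⁺ cycleConstraints-derivable (v-derivable ∷ []))
    where
    negUnit-derivable : ∀ i → Derivable (negUnit i , 0ℚ)
    negUnit-derivable i = 0ℚ , (λ _ → 0ℚ) , ≤-refl , ConeInc-0 A , refl ,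
      λ j → subst (negUnit i j ≤_) (solve 1 (λ x → con 0ℚ := con 0ℚ :+ con 0ℚ :* x) refl (v̂ j))
                  (negUnit≤0 i j)
    cycle-derivable : ∀ {p ts} → SimpleCycle A p ts → Derivable (toℚ ∘ effect A ts , 0ℚ)
    cycle-derivable {p} {ts} cycle =
      0ℚ , toℚ ∘ effect A ts , ≤-refl , Inc⇒ConeInc A (p , ts , cycle , λ _ → refl) , refl ,
      λ j → ≤-reflexive (solve 2 (λ e x → e := e :+ con 0ℚ :* x) refl (toℚ (effect A ts j)) (v̂ j))
    nonnegativity-derivable : All Derivable nonnegativity
    nonnegativity-derivable = All.map⁺ (All.tabulate λ {i} _ → negUnit-derivable i)
    cycleConstraints-derivable : All Derivable cycleConstraints
    cycleConstraints-derivable = All.map⁺ (All.tabulate (cycle-derivable ∘ simpleCycles-simple))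
    v-derivable : Derivable (v̂ , - 1ℚ)
    v-derivable = 1ℚ , (λ _ → 0ℚ) , <⇒≤ (positive⁻¹ 1ℚ) , ConeInc-0 A , refl ,
      λ j → ≤-reflexive (solve 1 (λ x → x := con 0ℚ :+ con 1ℚ :* x) refl (v̂ j))

  module _ (y : Vector ℚ d) (y-solves : All (y satisfies_) system) where
    private
      nonnegativity-solved = proj₁ (All.++⁻ nonnegativity y-solves)
      cycles-solved = proj₁ (All.++⁻ cycleConstraints (proj₂ (All.++⁻ nonnegativity y-solves)))
      v-solved = proj₂ (All.++⁻ cycleConstraints (proj₂ (All.++⁻ nonnegativity y-solves)))

    solution-nonnegative : ∀ i → 0ℚ ≤ y i
    solution-nonnegative i = subst (0ℚ ≤_) (⁻¹-involutive (y i))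
      (neg-antimono-≤ (subst (_≤ 0ℚ) (·-negUnit y i)
                             (All.lookup (All.map⁻ nonnegativity-solved) (∈-allFin i))))

    solution-cycles≤0 : ∀ {p ts} → SimpleCycle A p ts → dot y (effect A ts) ≤ 0ℚ
    solution-cycles≤0 {ts = ts} cycle = subst (_≤ 0ℚ) (sym (dot≡· y (effect A ts)))
      (All.lookup (All.map⁻ cycles-solved) (∈-simpleCycles cycle))

    solution-v≤-1 : dot y v ≤ - 1ℚ
    solution-v≤-1 = subst (_≤ - 1ℚ) (sym (dot≡· y v)) (All.head v-solved)

  refutation⇒coneWitness : Refutation Derivable → ∃ λ w → ConeInc A w × (∀ i → 0ℚ ≤ toℚ (v i) + w i)
  refutation⇒coneWitness (a , b , (ν , w , _ , w∈ , b≡-ν , a≤) , a≗0 , b<0) =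
    Vector.map (k *_) w , ConeInc-* A (<⇒≤ k>0) w∈ , v+k*w≥0
    where
    ν>0 : 0ℚ < ν
    ν>0 = subst (0ℚ <_) (⁻¹-involutive ν) (neg-antimono-< (subst (_< 0ℚ) b≡-ν b<0))
    k = proj₁ (pos⇒invertible ν>0)
    k>0 = proj₁ (proj₂ (pos⇒invertible ν>0))
    k*ν≡1 = proj₂ (proj₂ (pos⇒invertible ν>0))
    k*[w+νv]≡v+k*w : ∀ i → k * (w i + ν * v̂ i) ≡ v̂ i + k * w i
    k*[w+νv]≡v+k*w i = begin
      k * (w i + ν * v̂ i)
        ≡⟨ solve 4 (λ k w ν x → k :* (w :+ ν :* x) := (k :* ν) :* x :+ k :* w) refl k (w i) ν (v̂ i) ⟩
      (k * ν) * v̂ i + k * w i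
        ≡⟨ cong (λ kν → kν * v̂ i + k * w i) k*ν≡1 ⟩
      1ℚ * v̂ i + k * w i
        ≡⟨ cong (_+ k * w i) (*-identityˡ (v̂ i)) ⟩
      v̂ i + k * w i
        ∎
      where open ≡-Reasoning
    v+k*w≥0 : ∀ i → 0ℚ ≤ v̂ i + k * w i
    v+k*w≥0 i = subst₂ _≤_ (*-zeroʳ k) (k*[w+νv]≡v+k*w i)
      (*-monoˡ-≤-nonNeg k {{nonNegative (<⇒≤ k>0)}} (subst (_≤ w i + ν * v̂ i) (a≗0 i) (a≤ i)))

mainTheorem12 : ∀ {d : ℕ} (A : VASS d) → StronglyConnected A →
    (f : LinMap A) → MaximalQRF A f →
    ∀ (v : Fin d → ℤ) → Inc A v → dot (LinMap.c f) v ≡ 0ℚ →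
    ∃ λ (w : Fin d → ℚ) → ConeInc A w × (∀ i → 0ℚ ≤ toℚ (v i) + w i)
mainTheorem12 {d} A _ f f-max v v∈Inc c·v≡0 =
  Sum.[ ⊥-elim ∘ unsolvable , refutation⇒coneWitness ]′ (farkas d Derivable-cone system system-derivable)
  where
  open DualSystem A v
  unsolvable : ¬ Solvable system
  unsolvable (y , y-solves) = maximalQRF⇒noSeparatingVector A f f-max v v∈Inc c·v≡0 y
    (solution-nonnegative y y-solves) (solution-cycles≤0 y y-solves) (solution-v≤-1 y y-solves)
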